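{- Let $B=\langle D,+,.,-\rangle$ be a complete Boolean algebra, let $T$ be its twist algebra, and let $P=\{\langle a,b\rangle\in D\times D\mid a+b=1\}$ with the operations of $T$. Let $F$ be a set of designated values in $P$, and let implication be $x\supset y=-x+y$. Then $F\supseteq\{\langle 1,y\rangle\mid y\in D\}$ if and only if every Kripke frame $\mathcal{F}=\langle W,R\rangle$ satisfies $\mathcal{F}\Vdash_{P,F}\Box(\varphi\to\psi)\to(\Box\varphi\to\Box\psi)$ for all formulas $\varphi,\psi$.
   Context: The twist algebra of $B$ is $T=\langle D\times D,+,.,-\rangle$ with $\langle a,b\rangle+\langle c,d\rangle=\langle a+c,b.d\rangle$, $\langle a,b\rangle.\langle c,d\rangle=\langle a.c,b+d\rangle$, $-\langle a,b\rangle=\langle b,a\rangle$; its lattice order is $\langle a,b\rangle\le\langle c,d\rangle$ iff $a\le c$ and $b\ge d$. $\bigwedge S$ is the greatest lower bound of $S$. A set of designated values is an upward closed subset $F\subseteq P$. Formulas use $\land,\lor,\lnot,\to,\Box$. A normal modal valuation on a frame $\langle W,R\rangle$ is $v:W\times\mathrm{Form}\to P$ (write $v_w$) with $v_w(\varphi\lor\psi)=v_w(\varphi)+v_w(\psi)$, $v_w(\varphi\land\psi)=v_w(\varphi).v_w(\psi)$, $v_w(\lnot\varphi)=-v_w(\varphi)$, $v_w(\varphi\to\psi)=-v_w(\varphi)+v_w(\psi)$, $v_w(\Box\varphi)=\bigwedge\{v_{w'}(\varphi)\mid wRw'\}$, variables arbitrary in $P$. A $P$-model is $\langle W,R,v\rangle$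 with such $v$; $w\Vdash_{P,F}\varphi$ iff $v_w(\varphi)\in F$; a frame satisfies $\varphi$ if every world of every $P$-model on it does. -}

module Defs where

open import Level using (Level; _⊔_) renaming (suc to lsuc)
open import Data.Nat using (ℕ)
open import Data.Product using (Σ; _×_; _,_; proj₁; proj₂)
open import Algebra.Lattice.Bundles using (BooleanAlgebra)

data Form : Set where
  var  : ℕ → Form
  _∧ᶠ_ : Form → Form → Form
  _∨ᶠ_ : Form → Form → Form
  ¬ᶠ_  : Form → Form
  _⇒ᶠ_ : Form → Form → Form
  □_   : Form → Form

record Frame (i : Level) : Set (lsuc i) where
  field
    World : Set i
    Acc   : World → World → Set i

module Twist {c ℓ : Level} (B : BooleanAlgebra c ℓ) where
  open BooleanAlgebra B

  _≤B_ : Carrier → Carrier → Set ℓ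
  a ≤B b = (a ∧ b) ≈ a

  IsComplete : (i : Level) → Set (c ⊔ ℓ ⊔ lsuc i)
  IsComplete i = {I : Set i} (g : I → Carrier) →
    Σ Carrier λ m → ((k : I) → m ≤B g k) × ((x : Carrier) → ((k : I) → x ≤B g k) → x ≤B m)

  T : Set c
  T = Carrier × Carrier

  _+ᵀ_ : T → T → T
  (a , b) +ᵀ (c' , d) = (a ∨ c') , (b ∧ d)

  _·ᵀ_ : T → T → T
  (a , b) ·ᵀ (c' , d) = (a ∧ c') , (b ∨ d)

  -ᵀ_ : T → T
  -ᵀ (a , b) = b , a

  _≈ᵀ_ : T → T → Set ℓ
  (a , b) ≈ᵀ (c' , d) = (a ≈ c') × (b ≈ d)

  _≤ᵀ_ : T → T → Set ℓ
  (a , b) ≤ᵀ (c' , d) = (a ≤B c') × (d ≤B b)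

  InP : T → Set ℓ
  InP (a , b) = (a ∨ b) ≈ ⊤

  IsDesignated : {f : Level} → (T → Set f) → Set (c ⊔ ℓ ⊔ f)
  IsDesignated F = ((x : T) → F x → InP x)
                 × ((x y : T) → F x → InP y → x ≤ᵀ y → F y)

  module _ {i : Level} (Fr : Frame i) where
    open Frame Fr

    IsGlbPᵢ : {I : Set i} → (I → T) → T → Set (c ⊔ ℓ ⊔ i)
    IsGlbPᵢ {I} g m = InP m × ((k : I) → m ≤ᵀ g k)
                    × ((x : T) → InP x → ((k : I) → x ≤ᵀ g k) → x ≤ᵀ m)

    record Valuation : Set (c ⊔ ℓ ⊔ i) where
      field
        val   : World → Form → T
        inP   : ∀ w φ → InP (val w φ)
        v-∨   : ∀ w φ ψ → val w (φ ∨ᶠ ψ) ≈ᵀ (val w φ +ᵀ val w ψ)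
        v-∧   : ∀ w φ ψ → val w (φ ∧ᶠ ψ) ≈ᵀ (val w φ ·ᵀ val w ψ)
        v-¬   : ∀ w φ → val w (¬ᶠ φ) ≈ᵀ (-ᵀ val w φ)
        v-⇒   : ∀ w φ ψ → val w (φ ⇒ᶠ ψ) ≈ᵀ ((-ᵀ val w φ) +ᵀ val w ψ)
        v-□   : ∀ w φ → IsGlbPᵢ {Σ World (λ w' → Acc w w')}
                                 (λ p → val (proj₁ p) φ) (val w (□ φ))

    Forces : {f : Level} → (T → Set f) → Valuation → World → Form → Set f
    Forces F v w φ = F (Valuation.val v w φ)

    FrameSat : {f : Level} → (T → Set f) → Form → Set (c ⊔ ℓ ⊔ i ⊔ f)
    FrameSat F φ = (v : Valuation) (w : World) → Forces F v w φ

{-# OPTIONS --safe #-}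
module Submission where

-- Write A, B, C for the values of □(φ → ψ), □φ, □ψ at a world.  The value of
-- □(φ → ψ) → (□φ → □ψ) has first component a₂ ∨ b₂ ∨ c₁.  The element
-- ⟨¬(a₂ ∨ b₂), a₂ ∨ b₂⟩ of P lies below the value of ψ at every successor
-- (modus ponens inside the twist algebra), hence below their infimum C, and
-- this says exactly that a₂ ∨ b₂ ∨ c₁ = 1.  So the axiom only takes values
-- ⟨1, y⟩.  Conversely, on the reflexive one-point frame with every variable
-- valued ⟨1, y⟩ the axiom has a value below ⟨1, y⟩, so upward closure of F
-- forces ⟨1, y⟩ ∈ F.

open import Defs
open import Level using (Level; _⊔_)
open import Data.Nat using (ℕ)
open import Data.Product using (Σ; _×_; _,_; proj₁; proj₂)
open import Data.Unit.Polymorphic using (tt) renaming (⊤ to Unit)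
open import Algebra.Lattice.Bundles using (BooleanAlgebra)
open import Relation.Binary.Bundles using (Poset)
import Algebra.Lattice.Properties.BooleanAlgebra as BooleanAlgebraProperties
import Algebra.Lattice.Properties.Lattice as LatticeProperties
import Relation.Binary.Lattice as OrderLattice
import Relation.Binary.Lattice.Properties.MeetSemilattice as MeetSemilatticeProperties
import Relation.Binary.Lattice.Properties.JoinSemilattice as JoinSemilatticeProperties
import Relation.Binary.Reasoning.PartialOrder as ≤-Reasoning

module BooleanOrder {c ℓ : Level} (B : BooleanAlgebra c ℓ) where
  open BooleanAlgebra B
  open BooleanAlgebraProperties B using (∧-identityˡ; ∧-identityʳ; ∨-identityˡ)
  open LatticeProperties lattice using (∨-∧-orderTheoreticLattice)
  open LatticeProperties lattice public using (poset)
  open OrderLattice.Lattice ∨-∧-orderTheoreticLattice public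
    using (_≤_; x∧y≤x; x∧y≤y; ∧-greatest; x≤x∨y)
  open OrderLattice.Lattice ∨-∧-orderTheoreticLattice using (meetSemilattice; joinSemilattice)
  open MeetSemilatticeProperties meetSemilattice public using (∧-monotonic)
  open JoinSemilatticeProperties joinSemilattice public using (∨-monotonic)
  open Poset poset public
    using (≤-respʳ-≈; ≤-respˡ-≈)
    renaming (refl to ≤-refl; trans to ≤-trans; antisym to ≤-antisym; reflexive to ≤-reflexive)
  open ≤-Reasoning poset

  x≤⊤ : ∀ x → x ≤ ⊤
  x≤⊤ x = sym (∧-identityʳ x)

  ⊤≤x⇒x≈⊤ : ∀ {x} → ⊤ ≤ x → x ≈ ⊤
  ⊤≤x⇒x≈⊤ {x} = ≤-antisym (x≤⊤ x)

  x≤y∨z⇒x∧¬y≤z : ∀ {x y z} → x ≤ y ∨ z → x ∧ ¬ y ≤ z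
  x≤y∨z⇒x∧¬y≤z {x} {y} {z} x≤y∨z = begin
    x ∧ ¬ y                ≤⟨ ∧-monotonic x≤y∨z ≤-refl ⟩
    (y ∨ z) ∧ ¬ y          ≈⟨ ∧-distribʳ-∨ (¬ y) y z ⟩
    (y ∧ ¬ y) ∨ (z ∧ ¬ y)  ≈⟨ ∨-congʳ (∧-complementʳ y) ⟩
    ⊥ ∨ (z ∧ ¬ y)          ≈⟨ ∨-identityˡ (z ∧ ¬ y) ⟩
    z ∧ ¬ y                ≤⟨ x∧y≤x z (¬ y) ⟩
    z                      ∎

  x∧¬y≤z⇒x≤y∨z : ∀ {x y z} → x ∧ ¬ y ≤ z → x ≤ y ∨ z
  x∧¬y≤z⇒x≤y∨z {x} {y} {z} x∧¬y≤z = begin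
    x                      ≈⟨ sym (∧-identityʳ x) ⟩
    x ∧ ⊤                  ≈⟨ ∧-congˡ (sym (∨-complementʳ y)) ⟩
    x ∧ (y ∨ ¬ y)          ≈⟨ ∧-distribˡ-∨ x y (¬ y) ⟩
    (x ∧ y) ∨ (x ∧ ¬ y)    ≤⟨ ∨-monotonic (x∧y≤y x y) x∧¬y≤z ⟩
    y ∨ z                  ∎

  x∨y≈⊤⇒¬x≤y : ∀ {x y} → x ∨ y ≈ ⊤ → ¬ x ≤ y
  x∨y≈⊤⇒¬x≤y {x} {y} x∨y≈⊤ = begin
    ¬ x      ≈⟨ sym (∧-identityˡ (¬ x)) ⟩
    ⊤ ∧ ¬ x  ≤⟨ x≤y∨z⇒x∧¬y≤z (≤-reflexive (sym x∨y≈⊤)) ⟩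
    y        ∎

  ¬x≤y⇒x∨y≈⊤ : ∀ {x y} → ¬ x ≤ y → x ∨ y ≈ ⊤
  ¬x≤y⇒x∨y≈⊤ {x} {y} ¬x≤y = ⊤≤x⇒x≈⊤ (x∧¬y≤z⇒x≤y∨z (begin
    ⊤ ∧ ¬ x  ≈⟨ ∧-identityˡ (¬ x) ⟩
    ¬ x      ≤⟨ ¬x≤y ⟩
    y        ∎))

  ¬-antitone : ∀ {x y} → x ≤ y → ¬ y ≤ ¬ x
  ¬-antitone {x} {y} x≤y = x∨y≈⊤⇒¬x≤y (⊤≤x⇒x≈⊤ (begin
    ⊤        ≈⟨ sym (∨-complementʳ x) ⟩
    x ∨ ¬ x  ≤⟨ ∨-monotonic x≤y ≤-refl ⟩
    y ∨ ¬ x  ∎))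

module TwistProperties {c ℓ : Level} (B : BooleanAlgebra c ℓ) where
  open BooleanAlgebra B
  open BooleanAlgebraProperties B using (deMorgan₁; deMorgan₂)
  open BooleanOrder B
  open ≤-Reasoning poset
  open Twist B

  -- _≤B_ is a ∧ b ≈ a, whereas the library's natural order is a ≈ a ∧ b.
  ≤B⇒≤ : ∀ {a b} → a ≤B b → a ≤ b
  ≤B⇒≤ = sym

  ≤⇒≤B : ∀ {a b} → a ≤ b → a ≤B b
  ≤⇒≤B = sym

  ≤ᵀ-refl : ∀ x → x ≤ᵀ x
  ≤ᵀ-refl _ = ≤⇒≤B ≤-refl , ≤⇒≤B ≤-refl

  ≤ᵀ-respʳ-≈ᵀ : ∀ {x y z} → x ≤ᵀ y → y ≈ᵀ z → x ≤ᵀ z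
  ≤ᵀ-respʳ-≈ᵀ (x₁≤y₁ , y₂≤x₂) (y₁≈z₁ , y₂≈z₂) =
    ≤⇒≤B (≤-respʳ-≈ y₁≈z₁ (≤B⇒≤ x₁≤y₁)) , ≤⇒≤B (≤-respˡ-≈ y₂≈z₂ (≤B⇒≤ y₂≤x₂))

  _⊃ᵀ_ : T → T → T
  x ⊃ᵀ y = (-ᵀ x) +ᵀ y

  InP-+ᵀ : ∀ {x y} → InP x → InP y → InP (x +ᵀ y)
  InP-+ᵀ {x₁ , x₂} {y₁ , y₂} x∈P y∈P = ¬x≤y⇒x∨y≈⊤ (begin
    ¬ (x₁ ∨ y₁)  ≈⟨ deMorgan₂ x₁ y₁ ⟩
    ¬ x₁ ∧ ¬ y₁  ≤⟨ ∧-monotonic (x∨y≈⊤⇒¬x≤y x∈P) (x∨y≈⊤⇒¬x≤y y∈P) ⟩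
    x₂ ∧ y₂      ∎)

  InP-·ᵀ : ∀ {x y} → InP x → InP y → InP (x ·ᵀ y)
  InP-·ᵀ {x₁ , x₂} {y₁ , y₂} x∈P y∈P = ¬x≤y⇒x∨y≈⊤ (begin
    ¬ (x₁ ∧ y₁)  ≈⟨ deMorgan₁ x₁ y₁ ⟩
    ¬ x₁ ∨ ¬ y₁  ≤⟨ ∨-monotonic (x∨y≈⊤⇒¬x≤y x∈P) (x∨y≈⊤⇒¬x≤y y∈P) ⟩
    x₂ ∨ y₂      ∎)

  InP-swap : ∀ {x} → InP x → InP (-ᵀ x)
  InP-swap {x₁ , x₂} x∈P = trans (∨-comm x₂ x₁) x∈P

  InP-⊃ᵀ : ∀ {x y} → InP x → InP y → InP (x ⊃ᵀ y)
  InP-⊃ᵀ x∈P y∈P = InP-+ᵀ (InP-swap x∈P) y∈P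

  -- Only the second components of the premises matter: a ⊃ (b ⊃ c) has
  -- first component a₂ ∨ b₂ ∨ c₁.
  detach : T → T → T
  detach (_ , a₂) (_ , b₂) = ¬ (a₂ ∨ b₂) , a₂ ∨ b₂

  detach-InP : ∀ x y → InP (detach x y)
  detach-InP (_ , a₂) (_ , b₂) = ∨-complementˡ (a₂ ∨ b₂)

  detach-≤ᵀ : ∀ {a b p q} → InP a → InP p →
              a ≤ᵀ (p ⊃ᵀ q) → b ≤ᵀ p → detach a b ≤ᵀ q
  detach-≤ᵀ {a₁ , a₂} {b₁ , b₂} {p₁ , p₂} {q₁ , q₂} a∈P p∈P
            (a₁≤p₂∨q₁ , p₁∧q₂≤a₂) (_ , p₂≤b₂) = ≤⇒≤B first , ≤⇒≤B second
    where
    first : ¬ (a₂ ∨ b₂) ≤ q₁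
    first = begin
      ¬ (a₂ ∨ b₂)  ≈⟨ deMorgan₂ a₂ b₂ ⟩
      ¬ a₂ ∧ ¬ b₂  ≤⟨ ∧-monotonic (x∨y≈⊤⇒¬x≤y (InP-swap a∈P)) (¬-antitone (≤B⇒≤ p₂≤b₂)) ⟩
      a₁ ∧ ¬ p₂    ≤⟨ x≤y∨z⇒x∧¬y≤z (≤B⇒≤ a₁≤p₂∨q₁) ⟩
      q₁           ∎

    q₂∧¬p₂≤p₁∧q₂ : q₂ ∧ ¬ p₂ ≤ p₁ ∧ q₂
    q₂∧¬p₂≤p₁∧q₂ = ∧-greatest (≤-trans (x∧y≤y q₂ (¬ p₂)) (x∨y≈⊤⇒¬x≤y (InP-swap p∈P)))
                              (x∧y≤x q₂ (¬ p₂))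

    second : q₂ ≤ a₂ ∨ b₂
    second = begin
      q₂              ≤⟨ x∧¬y≤z⇒x≤y∨z q₂∧¬p₂≤p₁∧q₂ ⟩
      p₂ ∨ (p₁ ∧ q₂)  ≤⟨ ∨-monotonic (≤B⇒≤ p₂≤b₂) (≤B⇒≤ p₁∧q₂≤a₂) ⟩
      b₂ ∨ a₂         ≈⟨ ∨-comm b₂ a₂ ⟩
      a₂ ∨ b₂         ∎

  detach-≤ᵀ⇒⊃ᵀ-first-⊤ : ∀ x y {z} → detach x y ≤ᵀ z → proj₁ (x ⊃ᵀ (y ⊃ᵀ z)) ≈ ⊤
  detach-≤ᵀ⇒⊃ᵀ-first-⊤ (_ , a₂) (_ , b₂) {c₁ , _} (d≤c₁ , _) =
    trans (sym (∨-assoc a₂ b₂ c₁)) (¬x≤y⇒x∨y≈⊤ (≤B⇒≤ d≤c₁))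

  [x⊃x]⊃[x⊃x]≤ᵀx : ∀ {x} → proj₁ x ≈ ⊤ → ((x ⊃ᵀ x) ⊃ᵀ (x ⊃ᵀ x)) ≤ᵀ x
  [x⊃x]⊃[x⊃x]≤ᵀx {x₁ , x₂} x₁≈⊤ =
    ≤⇒≤B (≤-respʳ-≈ (sym x₁≈⊤) (x≤⊤ _)) ,
    ≤⇒≤B (∧-greatest (x≤x∨y x₂ x₁) (∧-greatest (≤-respʳ-≈ (sym x₁≈⊤) (x≤⊤ x₂)) ≤-refl))

module AxiomK {c ℓ : Level} (B : BooleanAlgebra c ℓ) where
  open BooleanAlgebra B using (_≈_; ⊤; refl; trans; ∨-congˡ)
  open Twist B
  open TwistProperties B

  K : Form → Form → Form
  K φ ψ = (□ (φ ⇒ᶠ ψ)) ⇒ᶠ ((□ φ) ⇒ᶠ (□ ψ))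

  TopFirstDesignated : {f : Level} → (T → Set f) → Set (c ⊔ ℓ ⊔ f)
  TopFirstDesignated F = (x : T) → InP x → proj₁ x ≈ ⊤ → F x

  module _ {i : Level} {Fr : Frame i} (v : Valuation Fr) where
    open Frame Fr
    open Valuation v

    K-first-⊤ : ∀ w φ ψ → proj₁ (val w (K φ ψ)) ≈ ⊤
    K-first-⊤ w φ ψ = trans (proj₁ (v-⇒ w (□ (φ ⇒ᶠ ψ)) ((□ φ) ⇒ᶠ (□ ψ))))
                     (trans (∨-congˡ (proj₁ (v-⇒ w (□ φ) (□ ψ))))
                            (detach-≤ᵀ⇒⊃ᵀ-first-⊤ a b detach≤□ψ))
      where
      a b : T
      a = val w (□ (φ ⇒ᶠ ψ))
      b = val w (□ φ)

      lowerBound : (k : Σ World (λ u → Acc w u)) → detach a b ≤ᵀ val (proj₁ k) ψ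
      lowerBound k@(u , _) = detach-≤ᵀ (inP w (□ (φ ⇒ᶠ ψ))) (inP u φ)
        (≤ᵀ-respʳ-≈ᵀ (proj₁ (proj₂ (v-□ w (φ ⇒ᶠ ψ))) k) (v-⇒ u φ ψ))
        (proj₁ (proj₂ (v-□ w φ)) k)

      detach≤□ψ : detach a b ≤ᵀ val w (□ ψ)
      detach≤□ψ = proj₂ (proj₂ (v-□ w ψ)) (detach a b) (detach-InP a b) lowerBound

  K-sound : ∀ {i f} {F : T → Set f} → TopFirstDesignated F →
            (Fr : Frame i) (φ ψ : Form) → FrameSat Fr F (K φ ψ)
  K-sound ⊤-first∈F _ φ ψ v w =
    ⊤-first∈F _ (Valuation.inP v w (K φ ψ)) (K-first-⊤ v w φ ψ)

  reflexivePoint : (i : Level) → Frame i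
  reflexivePoint _ = record { World = Unit ; Acc = λ _ _ → Unit }

  -- □ is the identity on the reflexive one-point frame.
  pointEval : (ℕ → T) → Form → T
  pointEval ρ (var n)  = ρ n
  pointEval ρ (φ ∧ᶠ ψ) = pointEval ρ φ ·ᵀ pointEval ρ ψ
  pointEval ρ (φ ∨ᶠ ψ) = pointEval ρ φ +ᵀ pointEval ρ ψ
  pointEval ρ (¬ᶠ φ)   = -ᵀ pointEval ρ φ
  pointEval ρ (φ ⇒ᶠ ψ) = pointEval ρ φ ⊃ᵀ pointEval ρ ψ
  pointEval ρ (□ φ)    = pointEval ρ φ

  pointEval-InP : ∀ {ρ} → (∀ n → InP (ρ n)) → ∀ φ → InP (pointEval ρ φ)
  pointEval-InP ρ∈P (var n)  = ρ∈P n
  pointEval-InP ρ∈P (φ ∧ᶠ ψ) = InP-·ᵀ (pointEval-InP ρ∈P φ) (pointEval-InP ρ∈P ψ)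
  pointEval-InP ρ∈P (φ ∨ᶠ ψ) = InP-+ᵀ (pointEval-InP ρ∈P φ) (pointEval-InP ρ∈P ψ)
  pointEval-InP ρ∈P (¬ᶠ φ)   = InP-swap (pointEval-InP ρ∈P φ)
  pointEval-InP ρ∈P (φ ⇒ᶠ ψ) = InP-⊃ᵀ (pointEval-InP ρ∈P φ) (pointEval-InP ρ∈P ψ)
  pointEval-InP ρ∈P (□ φ)    = pointEval-InP ρ∈P φ

  pointValuation : ∀ {i} (ρ : ℕ → T) → (∀ n → InP (ρ n)) → Valuation (reflexivePoint i)
  pointValuation ρ ρ∈P = record
    { val = λ _ → pointEval ρ
    ; inP = λ _ → pointEval-InP ρ∈P
    ; v-∨ = λ _ _ _ → refl , refl
    ; v-∧ = λ _ _ _ → refl , refl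
    ; v-¬ = λ _ _ → refl , refl
    ; v-⇒ = λ _ _ _ → refl , refl
    ; v-□ = λ _ φ → pointEval-InP ρ∈P φ , (λ _ → ≤ᵀ-refl (pointEval ρ φ)) ,
                    λ _ _ below → below (tt , tt)
    }

  K-complete : ∀ {i f} {F : T → Set f} → IsDesignated F →
               ((Fr : Frame i) (φ ψ : Form) → FrameSat Fr F (K φ ψ)) → TopFirstDesignated F
  K-complete {i} (_ , upward) K-valid x x∈P x₁≈⊤ =
    upward _ x (K-valid (reflexivePoint i) (var 0) (var 0) (pointValuation (λ _ → x) (λ _ → x∈P)) tt)
           x∈P ([x⊃x]⊃[x⊃x]≤ᵀx x₁≈⊤)

mainTheorem11 : {c ℓ : Level} (i f : Level) (B : BooleanAlgebra c ℓ) →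
    Twist.IsComplete B i →
    (F : Twist.T B → Set f) → Twist.IsDesignated B F →
    (((x : Twist.T B) → Twist.InP B x → BooleanAlgebra._≈_ B (proj₁ x) (BooleanAlgebra.⊤ B) → F x) →
      ((Fr : Frame i) (φ ψ : Form) → Twist.FrameSat B Fr F ((□ (φ ⇒ᶠ ψ)) ⇒ᶠ ((□ φ) ⇒ᶠ (□ ψ)))))
    × (((Fr : Frame i) (φ ψ : Form) → Twist.FrameSat B Fr F ((□ (φ ⇒ᶠ ψ)) ⇒ᶠ ((□ φ) ⇒ᶠ (□ ψ)))) →
      ((x : Twist.T B) → Twist.InP B x → BooleanAlgebra._≈_ B (proj₁ x) (BooleanAlgebra.⊤ B) → F x))
mainTheorem11 _ _ B _ _ F-designated = K-sound , K-complete F-designated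
  where open AxiomK B
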